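{- Let $D$ be an $n\times n$ matrix in the pre-strict-circular-Robinson class, let $i\in[n]$ and let $j\in\operatorname{NN}(i)$. Then for every Robinson ordering $\sigma$ of $D$, the elements $i$ and $j$ are consecutive, i.e. $\sigma(j)\equiv \sigma(i)\pm 1 \pmod n$.
   Context: $[n]=\{0,\dots,n-1\}$. A dissimilarity matrix is a real $n\times n$ nonnegative symmetric matrix with zero diagonal. Elements $i,j,k,\ell\in[n]$ are cyclically ordered if they are pairwise distinct and $(j-i \bmod n)<(k-i\bmod n)<(\ell-i \bmod n)$. A dissimilarity matrix $A$ is strict circular Robinson if $A(i,k)>\min\{A(j,k),A(k,\ell)\}$ for all cyclically ordered $i,j,k,\ell$. $D$ belongs to the pre-strict-circular-Robinson class if $D=\Pi A\Pi^T$ for some permutation matrix $\Pi$ and some strict circular Robinson matrix $A$. A Robinson ordering of $D$ is a permutation $\sigma$ of $[n]$ such that the matrix $A$ defined by $A(\sigma(a),\sigma(b))=D(a,b)$ is strict circular Robinson. $\operatorname{NN}(i)=\arg\min_{k\in[n]\setminus\{i\}} D(i,k)$ is the set of nearest neighbours of $i$. -}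

module Defs where

open import Level using (Level)
open import Data.Nat as ℕ using (ℕ; _∸_; _+_)
open import Data.Fin using (Fin; toℕ)
open import Data.Fin.Permutation using (Permutation′; _⟨$⟩ʳ_; _⟨$⟩ˡ_)
open import Data.Product using (_×_; ∃-syntax)
open import Data.Sum using (_⊎_)
open import Relation.Nullary using (¬_; yes; no)
open import Relation.Binary.PropositionalEquality using (_≡_)
open import Relation.Binary using (StrictTotalOrder; tri<; tri≈; tri>)

-- (b - a) mod n for a b : Fin n, written out without division:
-- b - a if a ≤ b, otherwise n + b - a.
offset : {n : ℕ} → Fin n → Fin n → ℕ
offset {n} a b with toℕ a ℕ.≤? toℕ b
... | yes _ = toℕ b ∸ toℕ a
... | no  _ = (n + toℕ b) ∸ toℕ a

CyclicallyOrdered : {n : ℕ} → Fin n → Fin n → Fin n → Fin n → Set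
CyclicallyOrdered i j k l =
  ¬ i ≡ j × ¬ i ≡ k × ¬ i ≡ l × ¬ j ≡ k × ¬ j ≡ l × ¬ k ≡ l ×
  (offset i j ℕ.< offset i k) × (offset i k ℕ.< offset i l)

-- Matrix entries live in an arbitrary strict total order (e.g. the reals)
-- with a designated zero element.
module _ {c ℓ₁ ℓ₂ : Level} (O : StrictTotalOrder c ℓ₁ ℓ₂) (𝟘 : StrictTotalOrder.Carrier O) where
  open StrictTotalOrder O renaming (Carrier to R)

  min : R → R → R
  min x y with compare x y
  ... | tri< _ _ _ = x
  ... | tri≈ _ _ _ = x
  ... | tri> _ _ _ = y

  Matrix : ℕ → Set c
  Matrix n = Fin n → Fin n → R

  IsDissimilarity : {n : ℕ} → Matrix n → Set (ℓ₁ Level.⊔ ℓ₂)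
  IsDissimilarity {n} A =
    (∀ i j → ¬ (A i j < 𝟘)) × (∀ i j → A i j ≈ A j i) × (∀ i → A i i ≈ 𝟘)

  IsStrictCircularRobinson : {n : ℕ} → Matrix n → Set (ℓ₁ Level.⊔ ℓ₂)
  IsStrictCircularRobinson {n} A =
    IsDissimilarity A ×
    (∀ i j k l → CyclicallyOrdered i j k l → min (A j k) (A k l) < A i k)

  -- D = Π A Πᵀ for some permutation matrix Π, i.e. D(a,b) = A(π a, π b)
  PreStrictCircularRobinson : {n : ℕ} → Matrix n → Set (c Level.⊔ ℓ₁ Level.⊔ ℓ₂)
  PreStrictCircularRobinson {n} D =
    ∃[ π ] ∃[ A ] (IsStrictCircularRobinson {n} A ×
                   (∀ a b → D a b ≈ A (π ⟨$⟩ʳ a) (π ⟨$⟩ʳ b)))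

  -- σ is a Robinson ordering of D: the matrix A with A(σ a, σ b) = D(a,b),
  -- i.e. A(x,y) = D(σ⁻¹ x, σ⁻¹ y), is strict circular Robinson.
  IsRobinsonOrdering : {n : ℕ} → Matrix n → Permutation′ n → Set (ℓ₁ Level.⊔ ℓ₂)
  IsRobinsonOrdering D σ =
    IsStrictCircularRobinson (λ x y → D (σ ⟨$⟩ˡ x) (σ ⟨$⟩ˡ y))

  IsNearestNeighbour : {n : ℕ} → Matrix n → Fin n → Fin n → Set (ℓ₂)
  IsNearestNeighbour D i j = ¬ j ≡ i × (∀ k → ¬ k ≡ i → ¬ (D i k < D i j))

Consecutive : {n : ℕ} → Fin n → Fin n → Set
Consecutive a b = offset a b ≡ 1 ⊎ offset b a ≡ 1

-- If a and b are not cyclically adjacent, then the positions d just before and c just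
-- after a both differ from b, so b, d, a, c are cyclically ordered, and the Robinson
-- inequality gives min (A a d) (A a c) < A a b: b is not a nearest neighbour of a in A.
-- A Robinson ordering σ carries nearest neighbours of D to nearest neighbours of the
-- Robinson matrix D (σ⁻¹ -) (σ⁻¹ -).
{-# OPTIONS --safe #-}
module Submission where

open import Defs
open import Level using (Level)
open import Data.Nat using (ℕ)
open import Data.Fin using (Fin)
open import Data.Fin.Permutation using (Permutation′; _⟨$⟩ʳ_)
open import Relation.Binary using (StrictTotalOrder)

open import Data.Nat using (suc; _+_; _∸_; _≤_; _<_; _≤?_; _<?_; _≟_; z≤n; s≤s; z<s)
open import Data.Nat.Properties
open import Data.Fin using (toℕ; fromℕ<)
open import Data.Fin.Properties using (toℕ<n; toℕ-fromℕ<; toℕ-injective)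
open import Data.Fin.Permutation using (_⟨$⟩ˡ_; inverseˡ; inverseʳ)
open import Data.Product using (_,_; proj₁; proj₂; ∃-syntax)
open import Function using (_∘′_; Injection)
open import Function.Properties.Inverse using (↔⇒↣)
open import Data.Sum using (_⊎_; inj₁; inj₂)
open import Data.Empty using (⊥-elim)
open import Relation.Nullary using (¬_; Dec; yes; no; contradiction)
open import Relation.Nullary.Decidable using (_⊎-dec_)
open import Relation.Binary using (tri<; tri≈; tri>)
open import Relation.Binary.PropositionalEquality

offset-≤ : ∀ {n} {a b : Fin n} → toℕ a ≤ toℕ b → offset a b ≡ toℕ b ∸ toℕ a
offset-≤ {a = a} {b} a≤b with toℕ a ≤? toℕ b
... | yes _   = refl
... | no  a≰b = contradiction a≤b a≰b

offset-≰ : ∀ {n} {a b : Fin n} → ¬ toℕ a ≤ toℕ b → offset a b ≡ (n + toℕ b) ∸ toℕ a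
offset-≰ {a = a} {b} a≰b with toℕ a ≤? toℕ b
... | yes a≤b = contradiction a≤b a≰b
... | no  _   = refl

offset-self : ∀ {n} (a : Fin n) → offset a a ≡ 0
offset-self a = trans (offset-≤ {a = a} ≤-refl) (n∸n≡0 (toℕ a))

offset<n : ∀ {n} (a b : Fin n) → offset a b < n
offset<n {n} a b with toℕ a ≤? toℕ b
... | yes _   = ≤-<-trans (m∸n≤m (toℕ b) (toℕ a)) (toℕ<n b)
... | no  a≰b = begin-strict
  n + toℕ b ∸ toℕ a <⟨ ∸-monoˡ-< (+-monoʳ-< n (≰⇒> a≰b)) (≤-trans (<⇒≤ (toℕ<n a)) (m≤m+n n (toℕ b))) ⟩
  n + toℕ a ∸ toℕ a ≡⟨ m+n∸n≡m n (toℕ a) ⟩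
  n                 ∎
  where open ≤-Reasoning

[n∸m]+[o+m∸n]≡o : ∀ {m n o} → m ≤ n → n ≤ o + m → (n ∸ m) + (o + m ∸ n) ≡ o
[n∸m]+[o+m∸n]≡o {m} {n} {o} m≤n n≤o+m = begin
  (n ∸ m) + (o + m ∸ n) ≡⟨ +-∸-assoc (n ∸ m) n≤o+m ⟨
  (n ∸ m) + (o + m) ∸ n ≡⟨ cong (_∸ n) n∸m+[o+m]≡n+o ⟩
  n + o ∸ n             ≡⟨ m+n∸m≡n n o ⟩
  o                     ∎
  where
  open ≡-Reasoning
  n∸m+[o+m]≡n+o : (n ∸ m) + (o + m) ≡ n + o
  n∸m+[o+m]≡n+o = begin
    (n ∸ m) + (o + m) ≡⟨ cong ((n ∸ m) +_) (+-comm o m) ⟩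
    (n ∸ m) + (m + o) ≡⟨ +-assoc (n ∸ m) m o ⟨
    (n ∸ m) + m + o   ≡⟨ cong (_+ o) (m∸n+n≡m m≤n) ⟩
    n + o             ∎

offset-+-offset : ∀ {n} {a b : Fin n} → a ≢ b → offset a b + offset b a ≡ n
offset-+-offset {n} {a} {b} a≢b with toℕ a ≤? toℕ b | toℕ b ≤? toℕ a
... | yes a≤b | yes b≤a = contradiction (toℕ-injective (≤-antisym a≤b b≤a)) a≢b
... | yes a≤b | no  _   = [n∸m]+[o+m∸n]≡o a≤b (≤-trans (<⇒≤ (toℕ<n b)) (m≤m+n n (toℕ a)))
... | no  _   | yes b≤a = trans (+-comm _ (toℕ a ∸ toℕ b))
                            ([n∸m]+[o+m∸n]≡o b≤a (≤-trans (<⇒≤ (toℕ<n a)) (m≤m+n n (toℕ b))))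
... | no  a≰b | no  b≰a = contradiction (≰⇒≥ a≰b) b≰a

offset-surjective : ∀ {n} (a : Fin n) {k} → k < n → ∃[ b ] offset a b ≡ k
offset-surjective {n} a {k} k<n with toℕ a + k <? n
... | yes a+k<n = fromℕ< a+k<n , (begin
  offset a (fromℕ< a+k<n) ≡⟨ offset-≤ (subst (toℕ a ≤_) (sym (toℕ-fromℕ< a+k<n)) (m≤m+n (toℕ a) k)) ⟩
  toℕ (fromℕ< a+k<n) ∸ toℕ a ≡⟨ cong (_∸ toℕ a) (toℕ-fromℕ< a+k<n) ⟩
  toℕ a + k ∸ toℕ a          ≡⟨ m+n∸m≡n (toℕ a) k ⟩
  k                          ∎)
  where open ≡-Reasoning
... | no  a+k≮n = fromℕ< wrapped<n , (begin
  offset a (fromℕ< wrapped<n) ≡⟨ offset-≰ (<⇒≱ (subst (_< toℕ a) (sym (toℕ-fromℕ< wrapped<n)) wrapped<a)) ⟩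
  n + toℕ (fromℕ< wrapped<n) ∸ toℕ a ≡⟨ cong (λ x → n + x ∸ toℕ a) (toℕ-fromℕ< wrapped<n) ⟩
  n + (toℕ a + k ∸ n) ∸ toℕ a        ≡⟨ cong (_∸ toℕ a) (m+[n∸m]≡n n≤a+k) ⟩
  toℕ a + k ∸ toℕ a                  ≡⟨ m+n∸m≡n (toℕ a) k ⟩
  k                                  ∎)
  where
  open ≡-Reasoning
  n≤a+k : n ≤ toℕ a + k
  n≤a+k = ≮⇒≥ a+k≮n
  wrapped<a : toℕ a + k ∸ n < toℕ a
  wrapped<a = subst (toℕ a + k ∸ n <_) (m+n∸n≡m (toℕ a) n) (∸-monoˡ-< (+-monoʳ-< (toℕ a) k<n) n≤a+k)
  wrapped<n : toℕ a + k ∸ n < n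
  wrapped<n = <-trans wrapped<a (toℕ<n a)

offset≢0 : ∀ {n} {a b : Fin n} → a ≢ b → offset a b ≢ 0
offset≢0 {n} {a} {b} a≢b ab≡0 =
  <-irrefl (subst (λ x → x + offset b a ≡ n) ab≡0 (offset-+-offset a≢b)) (offset<n b a)

2≤offset : ∀ {n} {a b : Fin n} → a ≢ b → offset a b ≢ 1 → 2 ≤ offset a b
2≤offset {a = a} {b} a≢b ab≢1 = 2≤ (offset a b) (offset≢0 a≢b) ab≢1
  where
  2≤ : ∀ x → x ≢ 0 → x ≢ 1 → 2 ≤ x
  2≤ 0             x≢0 _   = contradiction refl x≢0
  2≤ 1             _   x≢1 = contradiction refl x≢1
  2≤ (suc (suc _)) _   _   = s≤s (s≤s z≤n)

cyclicallyOrdered-fromOffsets : ∀ {n} {i j k l : Fin n} →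
  0 < offset i j → offset i j < offset i k → offset i k < offset i l → CyclicallyOrdered i j k l
cyclicallyOrdered-fromOffsets {i = i} {j} {k} {l} 0<ij ij<ik ik<il =
  i≢ 0<ij , i≢ 0<ik , i≢ (<-trans 0<ik ik<il) ,
  apart ij<ik , apart (<-trans ij<ik ik<il) , apart ik<il , ij<ik , ik<il
  where
  apart : ∀ {x y} → offset i x < offset i y → x ≢ y
  apart lt x≡y = <⇒≢ lt (cong (offset i) x≡y)
  i≢ : ∀ {x} → 0 < offset i x → i ≢ x
  i≢ {x} pos = apart (subst (_< offset i x) (sym (offset-self i)) pos)
  0<ik : 0 < offset i k
  0<ik = <-trans 0<ij ij<ik

¬Consecutive⇒flanked : ∀ {n} {a b : Fin n} → a ≢ b → ¬ Consecutive a b →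
  ∃[ d ] ∃[ c ] CyclicallyOrdered b d a c
¬Consecutive⇒flanked {n} {a} {b} a≢b ¬ab =
  let d , bd≡q+1 = offset-surjective b (<-trans q+1<ba (offset<n b a))
      c , bc≡ba+1 = offset-surjective b ba+1<n
  in d , c , cyclicallyOrdered-fromOffsets
       (subst (0 <_) (sym bd≡q+1) z<s)
       (subst (_< offset b a) (sym bd≡q+1) q+1<ba)
       (subst (offset b a <_) (sym bc≡ba+1) ≤-refl)
  where
  2≤ba : 2 ≤ offset b a
  2≤ba = 2≤offset (≢-sym a≢b) (¬ab ∘′ inj₂)
  q : ℕ
  q = proj₁ (m≤n⇒∃[o]m+o≡n 2≤ba)
  q+1<ba : suc q < offset b a
  q+1<ba = ≤-reflexive (proj₂ (m≤n⇒∃[o]m+o≡n 2≤ba))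
  ba+1<n : suc (offset b a) < n
  ba+1<n = begin
    2 + offset b a            ≡⟨ +-comm 2 (offset b a) ⟩
    offset b a + 2            ≤⟨ +-monoʳ-≤ (offset b a) (2≤offset a≢b (¬ab ∘′ inj₁)) ⟩
    offset b a + offset a b   ≡⟨ +-comm (offset b a) (offset a b) ⟩
    offset a b + offset b a   ≡⟨ offset-+-offset a≢b ⟩
    n                         ∎
    where open ≤-Reasoning

consecutive? : ∀ {n} (a b : Fin n) → Dec (Consecutive a b)
consecutive? a b = (offset a b ≟ 1) ⊎-dec (offset b a ≟ 1)

module _ {c ℓ₁ ℓ₂ : Level} (O : StrictTotalOrder c ℓ₁ ℓ₂) (𝟘 : StrictTotalOrder.Carrier O) where
  open StrictTotalOrder O using (<-resp-≈; compare) renaming (_<_ to _<ᴼ_)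

  min-<⇒⊎ : ∀ {x y z} → min O 𝟘 x y <ᴼ z → x <ᴼ z ⊎ y <ᴼ z
  min-<⇒⊎ {x} {y} with compare x y
  ... | tri< _ _ _ = inj₁
  ... | tri≈ _ _ _ = inj₁
  ... | tri> _ _ _ = inj₂

  nearestNeighbour⇒consecutive : ∀ {n} {A : Matrix O 𝟘 n} {a b : Fin n} →
    IsStrictCircularRobinson O 𝟘 A → IsNearestNeighbour O 𝟘 A a b → Consecutive a b
  nearestNeighbour⇒consecutive {a = a} {b} ((_ , A-sym , _) , robinson) (b≢a , nearest)
    with consecutive? a b
  ... | yes ab = ab
  ... | no ¬ab with ¬Consecutive⇒flanked (≢-sym b≢a) ¬ab
  ... | d , c , ordered@(_ , _ , _ , d≢a , _ , a≢c , _)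
    with min-<⇒⊎ (proj₁ <-resp-≈ (A-sym b a) (robinson b d a c ordered))
  ... | inj₁ Ada<Aab = ⊥-elim (nearest d d≢a (proj₂ <-resp-≈ (A-sym d a) Ada<Aab))
  ... | inj₂ Aac<Aab = ⊥-elim (nearest c (≢-sym a≢c) Aac<Aab)

  isNearestNeighbour-permute : ∀ {n} {D : Matrix O 𝟘 n} (σ : Permutation′ n) {i j : Fin n} →
    IsNearestNeighbour O 𝟘 D i j →
    IsNearestNeighbour O 𝟘 (λ x y → D (σ ⟨$⟩ˡ x) (σ ⟨$⟩ˡ y)) (σ ⟨$⟩ʳ i) (σ ⟨$⟩ʳ j)
  isNearestNeighbour-permute {D = D} σ {i} {j} (j≢i , nearest) =
    j≢i ∘′ Injection.injective (↔⇒↣ σ) ,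
    λ k k≢σi → subst₂ (λ x y → ¬ D x (σ ⟨$⟩ˡ k) <ᴼ D x y) (sym (inverseˡ σ)) (sym (inverseˡ σ))
                 (nearest (σ ⟨$⟩ˡ k) (λ σ⁻¹k≡i → k≢σi (trans (sym (inverseʳ σ)) (cong (σ ⟨$⟩ʳ_) σ⁻¹k≡i))))

lemma5p2 : {c ℓ₁ ℓ₂ : Level} (O : StrictTotalOrder c ℓ₁ ℓ₂) (𝟘 : StrictTotalOrder.Carrier O)
    (n : ℕ) (D : Matrix O 𝟘 n) →
    PreStrictCircularRobinson O 𝟘 D →
    (i j : Fin n) → IsNearestNeighbour O 𝟘 D i j →
    (σ : Permutation′ n) → IsRobinsonOrdering O 𝟘 D σ →
    Consecutive (σ ⟨$⟩ʳ i) (σ ⟨$⟩ʳ j)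
lemma5p2 O 𝟘 n D _ i j nearest σ robinson =
  nearestNeighbour⇒consecutive O 𝟘 robinson (isNearestNeighbour-permute O 𝟘 {D = D} σ nearest)
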